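{- Let $\mathcal A\subseteq\mathbb N$, $L$ an environment and $T,U$ terms. If $L\vdash_{\mathcal A}T:U$, then $L\vdash_{\mathcal A}U$.
   Context: Fix a nonempty set $\Sigma$ of sorts with decidable equality, an arbitrary function $\mathrm{next}:\Sigma\to\Sigma$, and a countably infinite set of variables. Terms and environments: $T,U,V,W ::= \star s \mid x \mid \mathrm{app}(V,T) \mid \lambda x{:}W.\,T \mid \mathrm{def}(x{=}V).\,T \mid \mathrm{cast}(U,T)$ ($s\in\Sigma$) and $L,K ::= \emptyset \mid K,x{:}W \mid K,x{=}V$. $\mathrm{app}(V,T)$ applies $T$ to $V$; $\lambda x{:}W.\,T$ (de Bruijn's abstraction) and $\mathrm{def}(x{=}V).\,T$ (local definition) bind $x$ in $T$; $\mathrm{cast}(U,T)$ annotates $T$ with expected type $U$; entries $x{:}W$ and $x{=}V$ bind $x$. Terms are modulo renaming of bound variables. Write $\mathsf{B}x[V]$ for either $\lambda x{:}V$ or $\mathrm{def}(x{=}V)$ and correspondingly $L,x[V]$ for $L,x{:}V$ resp. $L,x{=}V$. One step of bound rt-reduction $L\vdash T_1\to^nT_2$ is the smallest relation closed under: $L\vdash\mathrm{app}(V,\lambda x{:}W.\,T)\to^0\mathrm{def}(x{=}\mathrm{cast}(W,V)).\,T$; $K,x{=}V\vdash x\to^0V$; $L\vdash\mathrm{def}(x{=}V).\,T\to^0T$ if $x$ not free in $T$; $L\vdash\mathrm{app}(V,\mathrm{def}(x{=}W).\,T)\to^0\mathrm{def}(x{=}W).\,\mathrm{app}(V,T)$;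 $L\vdash\mathrm{cast}(U,T)\to^0T$; $L\vdash\star s\to^1\star\,\mathrm{next}(s)$; $K,x{:}W\vdash x\to^1W$; $L\vdash\mathrm{cast}(U,T)\to^1U$; if $K\vdash x\to^nT$, $y\neq x$, $y$ not free in $T$ then $K,y[V]\vdash x\to^nT$; if $L\vdash V_1\to^0V_2$ then $L\vdash\mathrm{app}(V_1,T)\to^0\mathrm{app}(V_2,T)$; if $L\vdash T_1\to^nT_2$ then $L\vdash\mathrm{app}(V,T_1)\to^n\mathrm{app}(V,T_2)$; if $L\vdash V_1\to^0V_2$ then $L\vdash\mathsf Bx[V_1].\,T\to^0\mathsf Bx[V_2].\,T$; if $L,x[V]\vdash T_1\to^nT_2$ then $L\vdash\mathsf Bx[V].\,T_1\to^n\mathsf Bx[V].\,T_2$; if $L\vdash U_1\to^0U_2$ then $L\vdash\mathrm{cast}(U_1,T)\to^0\mathrm{cast}(U_2,T)$; if $L\vdash T_1\to^0T_2$ then $L\vdash\mathrm{cast}(U,T_1)\to^0\mathrm{cast}(U,T_2)$; if $L\vdash U_1\to^1U_2$ and $L\vdash T_1\to^1T_2$ then $L\vdash\mathrm{cast}(U_1,T_1)\to^1\mathrm{cast}(U_2,T_2)$. $L\vdash T_1\to^{*n}T_2$ is the smallest relation with $L\vdash T\to^{*0}T$, containing single steps, and with $L\vdash T_1\to^{*n_1}T$, $L\vdash T\to^{*n_2}T_2$ implying $L\vdash T_1\to^{*n_1+n_2}T_2$. Validity $L\vdash_{\mathcal A}T$ is the smallest predicate closed under: $L\vdash_{\mathcal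 A}\star s$; if $K\vdash_{\mathcal A}V$ then $K,x[V]\vdash_{\mathcal A}x$; if $K\vdash_{\mathcal A}x$ and $y\neq x$ then $K,y[V]\vdash_{\mathcal A}x$; if $L\vdash_{\mathcal A}V$ and $L,x[V]\vdash_{\mathcal A}T$ then $L\vdash_{\mathcal A}\mathsf Bx[V].\,T$; if $L\vdash_{\mathcal A}U$, $L\vdash_{\mathcal A}T$ and some $U_0$ satisfies $L\vdash T\to^{*1}U_0$, $L\vdash U\to^{*0}U_0$, then $L\vdash_{\mathcal A}\mathrm{cast}(U,T)$; if $L\vdash_{\mathcal A}V$, $L\vdash_{\mathcal A}T$ and there are $n\in\mathcal A$, $x,W_0,U_0$ with $L\vdash T\to^{*n}\lambda x{:}W_0.\,U_0$ and $L\vdash V\to^{*1}W_0$, then $L\vdash_{\mathcal A}\mathrm{app}(V,T)$. The type judgment $L\vdash_{\mathcal A}T:U$ means $L\vdash_{\mathcal A}\mathrm{cast}(U,T)$. -}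

module Defs where

open import Data.Nat using (ℕ; zero; suc; _+_; _<ᵇ_)
open import Data.Bool using (if_then_else_)

-- Terms modulo renaming of bound variables are represented with de Bruijn
-- indices: var i refers to the i-th enclosing binder / environment entry,
-- counting from the innermost (right end) starting at 0.

data Bind : Set where
  lam : Bind
  abb : Bind

data Term (S : Set) : Set where
  sort : S → Term S
  var  : ℕ → Term S
  app  : Term S → Term S → Term S        -- app V T applies T to V
  bind : Bind → Term S → Term S → Term S
  cast : Term S → Term S → Term S

data Env (S : Set) : Set where
  ∅    : Env S
  _,[_]_ : Env S → Bind → Term S → Env S  -- K ,[ lam ] W  is  K,x:W ; K ,[ abb ] V  is  K,x=V

lift : {S : Set} → ℕ → Term S → Term S
lift c (sort s) = sort s
lift c (var i) = if i <ᵇ c then var i else var (suc i)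
lift c (app V T) = app (lift c V) (lift c T)
lift c (bind b V T) = bind b (lift c V) (lift (suc c) T)
lift c (cast U T) = cast (lift c U) (lift c T)

↑ : {S : Set} → Term S → Term S
↑ = lift 0

module _ {S : Set} (next : S → S) where

  data _⊢_→[_]_ : Env S → Term S → ℕ → Term S → Set where
    β     : ∀ {L V W T} → L ⊢ app V (bind lam W T) →[ 0 ] bind abb (cast W V) T
    δ     : ∀ {K V} → (K ,[ abb ] V) ⊢ var 0 →[ 0 ] ↑ V
    ζ     : ∀ {L V T} → L ⊢ bind abb V (↑ T) →[ 0 ] T
    θ     : ∀ {L V W T} → L ⊢ app V (bind abb W T) →[ 0 ] bind abb W (app (↑ V) T)
    ε     : ∀ {L U T} → L ⊢ cast U T →[ 0 ] T
    sortS : ∀ {L s} → L ⊢ sort s →[ 1 ] sort (next s)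
    ℓ     : ∀ {K W} → (K ,[ lam ] W) ⊢ var 0 →[ 1 ] ↑ W
    e     : ∀ {L U T} → L ⊢ cast U T →[ 1 ] U
    lref  : ∀ {K i n T b V} → K ⊢ var i →[ n ] T → (K ,[ b ] V) ⊢ var (suc i) →[ n ] ↑ T
    appV  : ∀ {L V₁ V₂ T} → L ⊢ V₁ →[ 0 ] V₂ → L ⊢ app V₁ T →[ 0 ] app V₂ T
    appT  : ∀ {L V T₁ T₂ n} → L ⊢ T₁ →[ n ] T₂ → L ⊢ app V T₁ →[ n ] app V T₂
    bindV : ∀ {L b V₁ V₂ T} → L ⊢ V₁ →[ 0 ] V₂ → L ⊢ bind b V₁ T →[ 0 ] bind b V₂ T
    bindT : ∀ {L b V T₁ T₂ n} → (L ,[ b ] V) ⊢ T₁ →[ n ] T₂ → L ⊢ bind b V T₁ →[ n ] bind b V T₂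
    castU : ∀ {L U₁ U₂ T} → L ⊢ U₁ →[ 0 ] U₂ → L ⊢ cast U₁ T →[ 0 ] cast U₂ T
    castT : ∀ {L U T₁ T₂} → L ⊢ T₁ →[ 0 ] T₂ → L ⊢ cast U T₁ →[ 0 ] cast U T₂
    castB : ∀ {L U₁ U₂ T₁ T₂} → L ⊢ U₁ →[ 1 ] U₂ → L ⊢ T₁ →[ 1 ] T₂ →
            L ⊢ cast U₁ T₁ →[ 1 ] cast U₂ T₂

  data _⊢_→*[_]_ : Env S → Term S → ℕ → Term S → Set where
    refl* : ∀ {L T} → L ⊢ T →*[ 0 ] T
    step* : ∀ {L T₁ T₂ n} → L ⊢ T₁ →[ n ] T₂ → L ⊢ T₁ →*[ n ] T₂
    trans* : ∀ {L T₁ T T₂ n₁ n₂} → L ⊢ T₁ →*[ n₁ ] T → L ⊢ T →*[ n₂ ] T₂ →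
             L ⊢ T₁ →*[ n₁ + n₂ ] T₂

  data ⊢valid (𝒜 : ℕ → Set) : Env S → Term S → Set where
    vSort : ∀ {L s} → ⊢valid 𝒜 L (sort s)
    vVar0 : ∀ {K b V} → ⊢valid 𝒜 K V → ⊢valid 𝒜 (K ,[ b ] V) (var 0)
    vVarS : ∀ {K b V i} → ⊢valid 𝒜 K (var i) → ⊢valid 𝒜 (K ,[ b ] V) (var (suc i))
    vBind : ∀ {L b V T} → ⊢valid 𝒜 L V → ⊢valid 𝒜 (L ,[ b ] V) T → ⊢valid 𝒜 L (bind b V T)
    vCast : ∀ {L U T} → ⊢valid 𝒜 L U → ⊢valid 𝒜 L T →
            (U₀ : Term S) → L ⊢ T →*[ 1 ] U₀ → L ⊢ U →*[ 0 ] U₀ →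
            ⊢valid 𝒜 L (cast U T)
    vApp  : ∀ {L V T} → ⊢valid 𝒜 L V → ⊢valid 𝒜 L T →
            (n : ℕ) → 𝒜 n → (W₀ U₀ : Term S) →
            L ⊢ T →*[ n ] bind lam W₀ U₀ → L ⊢ V →*[ 1 ] W₀ →
            ⊢valid 𝒜 L (app V T)

  ⊢typed : (𝒜 : ℕ → Set) → Env S → Term S → Term S → Set
  ⊢typed 𝒜 L T U = ⊢valid 𝒜 L (cast U T)

module Submission where

-- The type judgment  L ⊢[𝒜] T : U  is by definition the validity of the
-- annotated term  cast(U,T), and validity is an inductive predicate whose
-- only rule concluding  L ⊢[𝒜] cast(U,T)  is the cast rule.  That rule has
-- L ⊢[𝒜] U  among its premises, so the theorem is the inversion principle
-- of validity at a cast.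

open import Defs
open import Data.Nat using (ℕ)
open import Data.Product using (Σ; _×_; _,_; proj₁)
open import Relation.Binary.Definitions using (DecidableEquality)

module _ {S : Set} (next : S → S) (𝒜 : ℕ → Set) where

  CastPremises : Env S → Term S → Term S → Set
  CastPremises L U T =
    ⊢valid next 𝒜 L U × ⊢valid next 𝒜 L T ×
    Σ (Term S) λ U₀ → _⊢_→*[_]_ next L T 1 U₀ × _⊢_→*[_]_ next L U 0 U₀

  valid-cast-inv : ∀ {L U T} → ⊢valid next 𝒜 L (cast U T) → CastPremises L U T
  valid-cast-inv (vCast hU hT U₀ T→U₀ U→U₀) = hU , hT , U₀ , T→U₀ , U→U₀

theorem5p4 : (S : Set) → S → DecidableEquality S → (next : S → S) →
    (𝒜 : ℕ → Set) (L : Env S) (T U : Term S) →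
    ⊢typed next 𝒜 L T U → ⊢valid next 𝒜 L U
theorem5p4 S _ _ next 𝒜 L T U T∶U = proj₁ (valid-cast-inv next 𝒜 T∶U)
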